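{- Let $b,c\geqslant 1$ be integers. If there exists a signed magic array set $\mathrm{SMAS}(6,b;c)$, then there exists a signed magic array set $\mathrm{SMAS}(6,b+4;c)$.
   Context: For positive integers $a,b,e$, a signed magic array set $\mathrm{SMAS}(a,b;e)$ is a set of $e$ (completely filled) arrays of size $a\times b$ with entries in $\Omega\subset\mathbb{Z}$, where $\Omega=\{0,\pm1,\pm2,\ldots,\pm(abe-1)/2\}$ if $abe$ is odd and $\Omega=\{\pm1,\pm2,\ldots,\pm abe/2\}$ if $abe$ is even, such that (a) every $\omega\in\Omega$ appears exactly once and in a unique array; (b) for every array, the sum of the elements in each row and in each column is $0$. -}

module Defs where

open import Data.Nat as ℕ using (ℕ; _*_)
open import Data.Nat.Base using (_/_)
open import Data.Nat.Divisibility using (_∣_)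
open import Data.Integer as ℤ using (ℤ; +_; ∣_∣)
open import Data.Fin using (Fin; zero; suc)
open import Data.Product using (_×_; Σ; ∃; _,_)
open import Relation.Nullary using (¬_)
open import Relation.Binary.PropositionalEquality using (_≡_; _≢_)

∑ : (n : ℕ) → (Fin n → ℤ) → ℤ
∑ ℕ.zero    f = + 0
∑ (ℕ.suc n) f = f zero ℤ.+ ∑ n (λ i → f (suc i))

Ω : ℕ → ℤ → Set
Ω N x = (¬ (2 ∣ N) → ∣ x ∣ ℕ.≤ (N ℕ.∸ 1) / 2)
      × (2 ∣ N → (x ≢ + 0) × (∣ x ∣ ℕ.≤ N / 2))

record SMAS (a b e : ℕ) : Set where
  field
    A        : Fin e → Fin a → Fin b → ℤ
    inΩ      : ∀ k i j → Ω (a * b * e) (A k i j)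
    covers   : ∀ ω → Ω (a * b * e) ω → ∃ λ k → ∃ λ i → ∃ λ j → A k i j ≡ ω
    injective : ∀ k i j k′ i′ j′ → A k i j ≡ A k′ i′ j′ →
                (k ≡ k′) × (i ≡ i′) × (j ≡ j′)
    rowSum   : ∀ k i → ∑ b (λ j → A k i j) ≡ + 0
    colSum   : ∀ k j → ∑ a (λ i → A k i j) ≡ + 0

-- Since 6·b·c is even, the entries of an SMAS(6,b;c) are exactly ±1, …, ±3bc.
-- Widen array k by a fixed 6×4 block whose entries are ±(X + 1), …, ±(X + 12)
-- with X = 3bc + 12k, each value used once.  Every row of the block has two
-- positive and two negative entries and every column three of each, so the
-- offset X cancels in all line sums, and the block lines sum to zero because
-- they already do for X = 0.  The c blocks use up precisely the new values
-- ±(3bc + 1), …, ±(3bc + 12c) = ±3(b+4)c.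
module Submission where

open import Defs
open import Data.Nat as ℕ using (ℕ; suc; _≥_; _+_; _*_; _∸_; _≤_; _<_)
import Data.Nat.Properties as ℕ
open import Data.Nat.DivMod using (_mod_; m*n/n≡m)
open import Data.Nat.Divisibility using (divides)
open import Data.Nat.Tactic.RingSolver using (solve-∀)
open import Data.Integer as ℤ using (ℤ; +_; -_; ∣_∣; _◃_; sign)
import Data.Integer.Properties as ℤ
open import Algebra.Properties.CommutativeSemigroup ℤ.+-commutativeSemigroup using (interchange)
open import Data.Sign as Sign using (Sign)
open import Data.Fin as Fin using (Fin; zero; suc; toℕ; fromℕ<; splitAt; join; combine)
open import Data.Fin.Properties
  using (all?; any?; toℕ-injective; toℕ<n; toℕ-fromℕ<; toℕ-combine;
         combine-injective; combine-surjective; splitAt-join; join-splitAt)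
open import Data.Vec using (Vec; []; _∷_; lookup)
open import Data.Product using (_×_; ∃; ∃₂; _,_; proj₁; proj₂)
open import Data.Product.Properties using (≡-dec)
open import Data.Sum using (_⊎_; inj₁; inj₂; [_,_]′; map₁)
open import Data.Empty using (⊥-elim)
open import Function using (_⇔_; mk⇔; Equivalence)
open import Relation.Binary.Definitions using (DecidableEquality)
open import Relation.Nullary.Decidable using (Dec; yes; no; toWitness; _×-dec_; _→-dec_)
open import Relation.Binary.PropositionalEquality

∑-splitAt : ∀ m n (f : Fin m ⊎ Fin n → ℤ) →
            ∑ (m + n) (λ j → f (splitAt m j)) ≡ ∑ m (λ i → f (inj₁ i)) ℤ.+ ∑ n (λ i → f (inj₂ i))
∑-splitAt ℕ.zero    n f = sym (ℤ.+-identityˡ _)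
∑-splitAt (suc m) n f = begin
  f (inj₁ zero) ℤ.+ ∑ (m + n) (λ j → f (map₁ suc (splitAt m j)))
    ≡⟨ cong (λ z → f (inj₁ zero) ℤ.+ z) (∑-splitAt m n (λ u → f (map₁ suc u))) ⟩
  f (inj₁ zero) ℤ.+ (∑ m (λ i → f (inj₁ (suc i))) ℤ.+ ∑ n (λ i → f (inj₂ i)))
    ≡⟨ ℤ.+-assoc (f (inj₁ zero)) _ _ ⟨
  ∑ (suc m) (λ i → f (inj₁ i)) ℤ.+ ∑ n (λ i → f (inj₂ i)) ∎
  where open ≡-Reasoning

splitAt-injective : ∀ m {n} (j j′ : Fin (m + n)) → splitAt m j ≡ splitAt m j′ → j ≡ j′
splitAt-injective m {n} j j′ eq = begin
  j                       ≡⟨ join-splitAt m n j ⟨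
  join m n (splitAt m j)  ≡⟨ cong (join m n) eq ⟩
  join m n (splitAt m j′) ≡⟨ join-splitAt m n j′ ⟩
  j′                      ∎
  where open ≡-Reasoning

∑-cong : ∀ n {f g : Fin n → ℤ} → (∀ i → f i ≡ g i) → ∑ n f ≡ ∑ n g
∑-cong ℕ.zero    f≗g = refl
∑-cong (suc n) f≗g = cong₂ ℤ._+_ (f≗g zero) (∑-cong n (λ i → f≗g (suc i)))

∑-distrib-+ : ∀ n (f g : Fin n → ℤ) → ∑ n (λ i → f i ℤ.+ g i) ≡ ∑ n f ℤ.+ ∑ n g
∑-distrib-+ ℕ.zero    f g = refl
∑-distrib-+ (suc n) f g =
  trans (cong (λ z → (f zero ℤ.+ g zero) ℤ.+ z) (∑-distrib-+ n (λ i → f (suc i)) (λ i → g (suc i))))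
        (interchange (f zero) (g zero) _ _)

∑-*ʳ : ∀ n (f : Fin n → ℤ) x → ∑ n (λ i → f i ℤ.* x) ≡ ∑ n f ℤ.* x
∑-*ʳ ℕ.zero    f x = refl
∑-*ʳ (suc n) f x = begin
  f zero ℤ.* x ℤ.+ ∑ n (λ i → f (suc i) ℤ.* x)  ≡⟨ cong (λ z → f zero ℤ.* x ℤ.+ z) (∑-*ʳ n (λ i → f (suc i)) x) ⟩
  f zero ℤ.* x ℤ.+ ∑ n (λ i → f (suc i)) ℤ.* x  ≡⟨ ℤ.*-distribʳ-+ x (f zero) _ ⟨
  ∑ (suc n) f ℤ.* x                              ∎
  where open ≡-Reasoning

Ω-double : ∀ {N m x} → N ≡ m * 2 → Ω N x ⇔ (x ≢ + 0 × ∣ x ∣ ≤ m)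
Ω-double {N} {m} {x} N≡2m = mk⇔ to from
  where
  2∣N = divides m N≡2m
  N/2≡m : N ℕ./ 2 ≡ m
  N/2≡m = trans (cong (ℕ._/ 2) N≡2m) (m*n/n≡m m 2)
  to : Ω N x → x ≢ + 0 × ∣ x ∣ ≤ m
  to (_ , even) with even 2∣N
  ... | x≢0 , ∣x∣≤N/2 = x≢0 , subst (∣ x ∣ ≤_) N/2≡m ∣x∣≤N/2
  from : x ≢ + 0 × ∣ x ∣ ≤ m → Ω N x
  from (x≢0 , ∣x∣≤m) = (λ N-odd → ⊥-elim (N-odd 2∣N))
                     , (λ _ → x≢0 , subst (∣ x ∣ ≤_) (sym N/2≡m) ∣x∣≤m)

s◃n≡[s◃1]*n : ∀ s n → s ◃ n ≡ (s ◃ 1) ℤ.* + n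
s◃n≡[s◃1]*n Sign.+ n = trans (ℤ.+◃n≡+n n) (sym (ℤ.*-identityˡ (+ n)))
s◃n≡[s◃1]*n Sign.- n = trans (ℤ.-◃n≡-n n) (sym (ℤ.-1*i≡-i (+ n)))

Label : Set
Label = Sign × Fin 12

_≟ᴸ_ : DecidableEquality Label
_≟ᴸ_ = ≡-dec Sign._≟_ Fin._≟_

value : Label → ℤ
value (s , t) = s ◃ suc (toℕ t)

shifted : ℕ → Label → ℤ
shifted X (s , t) = s ◃ (suc (toℕ t) + X)

Balanced : (n : ℕ) → (Fin n → Label) → Set
Balanced n ℓ = ∑ n (λ j → proj₁ (ℓ j) ◃ 1) ≡ + 0 × ∑ n (λ j → value (ℓ j)) ≡ + 0

balanced? : ∀ n ℓ → Dec (Balanced n ℓ)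
balanced? n ℓ = (_ ℤ.≟ + 0) ×-dec (_ ℤ.≟ + 0)

shifted≡value+offset : ∀ X l → shifted X l ≡ value l ℤ.+ (proj₁ l ◃ 1) ℤ.* + X
shifted≡value+offset X (s , t) =
  trans (ℤ.◃-distrib-+ s (suc (toℕ t)) X) (cong (λ z → (s ◃ suc (toℕ t)) ℤ.+ z) (s◃n≡[s◃1]*n s X))

∑-shifted-balanced : ∀ n ℓ → Balanced n ℓ → ∀ X → ∑ n (λ j → shifted X (ℓ j)) ≡ + 0
∑-shifted-balanced n ℓ (∑signs≡0 , ∑values≡0) X = begin
  ∑ n (λ j → shifted X (ℓ j))
    ≡⟨ ∑-cong n (λ j → shifted≡value+offset X (ℓ j)) ⟩
  ∑ n (λ j → value (ℓ j) ℤ.+ (proj₁ (ℓ j) ◃ 1) ℤ.* + X)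
    ≡⟨ ∑-distrib-+ n _ _ ⟩
  ∑ n (λ j → value (ℓ j)) ℤ.+ ∑ n (λ j → (proj₁ (ℓ j) ◃ 1) ℤ.* + X)
    ≡⟨ cong₂ ℤ._+_ ∑values≡0 (trans (∑-*ʳ n _ (+ X)) (cong (ℤ._* + X) ∑signs≡0)) ⟩
  + 0 ∎
  where open ≡-Reasoning

table : Vec (Vec ℤ 4) 6
table = (- + 12 ∷   + 10 ∷   + 3 ∷  - + 1 ∷ [])
      ∷ (   + 2 ∷  - + 5 ∷ - + 3 ∷    + 6 ∷ [])
      ∷ (   + 7 ∷ - + 11 ∷ - + 4 ∷    + 8 ∷ [])
      ∷ ( - + 2 ∷    + 1 ∷   + 9 ∷  - + 8 ∷ [])
      ∷ ( - + 7 ∷   + 11 ∷ - + 9 ∷    + 5 ∷ [])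
      ∷ (  + 12 ∷  - + 6 ∷   + 4 ∷ - + 10 ∷ [])
      ∷ []

block : Fin 6 → Fin 4 → Label
block i x = let v = lookup (lookup table i) x in sign v , (∣ v ∣ ∸ 1) mod 12

block-rows-balanced : ∀ i → Balanced 4 (block i)
block-rows-balanced = toWitness {a? = all? λ i → balanced? 4 (block i)} _

block-columns-balanced : ∀ x → Balanced 6 (λ i → block i x)
block-columns-balanced = toWitness {a? = all? λ x → balanced? 6 (λ i → block i x)} _

block-injective : ∀ i x i′ x′ → block i x ≡ block i′ x′ → i ≡ i′ × x ≡ x′
block-injective = toWitness {a? = all? λ i → all? λ x → all? λ i′ → all? λ x′ →
  (block i x ≟ᴸ block i′ x′) →-dec ((i Fin.≟ i′) ×-dec (x Fin.≟ x′))} _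

block-surjective : ∀ l → ∃₂ λ i x → block i x ≡ l
block-surjective (Sign.+ , t) = toWitness {a? = all? λ t → any? λ i → any? λ x → block i x ≟ᴸ (Sign.+ , t)} _ t
block-surjective (Sign.- , t) = toWitness {a? = all? λ t → any? λ i → any? λ x → block i x ≟ᴸ (Sign.- , t)} _ t

layer : ∀ {c} (h : ℕ) → Fin c → Label → ℤ
layer h k = shifted (12 * toℕ k + h)

∣layer∣ : ∀ {c} h (k : Fin c) s t → ∣ layer h k (s , t) ∣ ≡ suc (toℕ (combine k t) + h)
∣layer∣ h k s t = begin
  ∣ layer h k (s , t) ∣        ≡⟨ ℤ.abs-◃ s _ ⟩
  suc (toℕ t + (12 * toℕ k + h)) ≡⟨ cong suc (reorder (toℕ t) (toℕ k) h) ⟩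
  suc (12 * toℕ k + toℕ t + h)   ≡⟨ cong (λ n → suc (n + h)) (toℕ-combine k t) ⟨
  suc (toℕ (combine k t) + h)    ∎
  where
  open ≡-Reasoning
  reorder : ∀ t k h → t + (12 * k + h) ≡ 12 * k + t + h
  reorder = solve-∀

layer-injective : ∀ {c} h (k k′ : Fin c) l l′ → layer h k l ≡ layer h k′ l′ → k ≡ k′ × l ≡ l′
layer-injective h k k′ (s , t) (s′ , t′) eq =
  proj₁ k,t≡k′,t′ , cong₂ _,_ (ℤ.sign-cong eq) (proj₂ k,t≡k′,t′)
  where
  open ≡-Reasoning
  k,t≡k′,t′ = combine-injective k t k′ t′ (toℕ-injective (ℕ.+-cancelʳ-≡ h _ _ (ℕ.suc-injective (begin
    suc (toℕ (combine k t) + h)    ≡⟨ ∣layer∣ h k s t ⟨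
    ∣ layer h k (s , t) ∣          ≡⟨ cong ∣_∣ eq ⟩
    ∣ layer h k′ (s′ , t′) ∣       ≡⟨ ∣layer∣ h k′ s′ t′ ⟩
    suc (toℕ (combine k′ t′) + h)  ∎))))

layer-surjective : ∀ h c ω → h < ∣ ω ∣ → ∣ ω ∣ ≤ c * 12 + h → ∃₂ λ (k : Fin c) l → layer h k l ≡ ω
layer-surjective h c ω h<∣ω∣ ∣ω∣≤ = k , (sign ω , t) , ℤ.◃-cong (ℤ.sign-◃ (sign ω) _) (begin
  ∣ layer h k (sign ω , t) ∣      ≡⟨ ∣layer∣ h k (sign ω) t ⟩
  suc (toℕ (combine k t) + h)    ≡⟨ cong (λ n → suc (toℕ n + h)) combine≡ ⟩
  suc (toℕ (fromℕ< r<) + h)      ≡⟨ cong (λ n → suc (n + h)) (toℕ-fromℕ< r<) ⟩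
  suc (r + h)                    ≡⟨ ∣ω∣≡ ⟩
  ∣ ω ∣                          ∎)
  where
  open ≡-Reasoning
  r = ∣ ω ∣ ∸ suc h
  ∣ω∣≡ : suc (r + h) ≡ ∣ ω ∣
  ∣ω∣≡ = trans (sym (ℕ.+-suc r h)) (ℕ.m∸n+n≡m h<∣ω∣)
  r< : r < c * 12
  r< = ℕ.+-cancelʳ-≤ h (suc r) (c * 12) (subst (_≤ c * 12 + h) (sym ∣ω∣≡) ∣ω∣≤)
  k = proj₁ (combine-surjective {c} {12} (fromℕ< r<))
  t = proj₁ (proj₂ (combine-surjective {c} {12} (fromℕ< r<)))
  combine≡ = proj₂ (proj₂ (combine-surjective {c} {12} (fromℕ< r<)))

module Extension {b c : ℕ} (S : SMAS 6 b c) where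
  open SMAS S

  h : ℕ
  h = 3 * b * c

  Ω-old : ∀ {x} → Ω (6 * b * c) x ⇔ (x ≢ + 0 × ∣ x ∣ ≤ h)
  Ω-old = Ω-double (6bc≡3bc*2 b c)
    where
    6bc≡3bc*2 : ∀ b c → 6 * b * c ≡ 3 * b * c * 2
    6bc≡3bc*2 = solve-∀

  Ω-new : ∀ {x} → Ω (6 * (b + 4) * c) x ⇔ (x ≢ + 0 × ∣ x ∣ ≤ c * 12 + h)
  Ω-new = Ω-double (6[b+4]c≡[12c+3bc]*2 b c)
    where
    6[b+4]c≡[12c+3bc]*2 : ∀ b c → 6 * (b + 4) * c ≡ (c * 12 + 3 * b * c) * 2
    6[b+4]c≡[12c+3bc]*2 = solve-∀

  layer-bounds : ∀ (k : Fin c) l → h < ∣ layer h k l ∣ × ∣ layer h k l ∣ ≤ c * 12 + h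
  layer-bounds k (s , t) =
      subst (h <_) (sym ∣L∣≡) (ℕ.s≤s (ℕ.m≤n+m h _))
    , subst (_≤ c * 12 + h) (sym ∣L∣≡) (ℕ.+-monoˡ-≤ h (toℕ<n (combine k t)))
    where
    ∣L∣≡ : ∣ layer h k (s , t) ∣ ≡ suc (toℕ (combine k t) + h)
    ∣L∣≡ = ∣layer∣ h k s t

  old≢layer : ∀ k i x (k′ : Fin c) l → A k i x ≢ layer h k′ l
  old≢layer k i x k′ l eq =
    ℕ.<⇒≱ (proj₁ (layer-bounds k′ l)) (subst (_≤ h) (cong ∣_∣ eq) (proj₂ (Equivalence.to Ω-old (inΩ k i x))))

  entry : Fin c → Fin 6 → Fin b ⊎ Fin 4 → ℤ
  entry k i = [ A k i , (λ x → layer h k (block i x)) ]′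

  entry-bounds : ∀ k i u → entry k i u ≢ + 0 × ∣ entry k i u ∣ ≤ c * 12 + h
  entry-bounds k i (inj₁ x) = proj₁ A-bounds , ℕ.≤-trans (proj₂ A-bounds) (ℕ.m≤n+m h _)
    where
    A-bounds : A k i x ≢ + 0 × ∣ A k i x ∣ ≤ h
    A-bounds = Equivalence.to Ω-old (inΩ k i x)
  entry-bounds k i (inj₂ x) = L≢0 , proj₂ L-bounds
    where
    L-bounds = layer-bounds k (block i x)
    L≢0 : layer h k (block i x) ≢ + 0
    L≢0 L≡0 = ℕ.n≮0 (subst (h <_) (cong ∣_∣ L≡0) (proj₁ L-bounds))

  entry-injective : ∀ k i u k′ i′ u′ → entry k i u ≡ entry k′ i′ u′ → k ≡ k′ × i ≡ i′ × u ≡ u′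
  entry-injective k i (inj₁ x) k′ i′ (inj₁ x′) eq =
    let k≡k′ , i≡i′ , x≡x′ = injective k i x k′ i′ x′ eq in k≡k′ , i≡i′ , cong inj₁ x≡x′
  entry-injective k i (inj₁ x) k′ i′ (inj₂ x′) eq = ⊥-elim (old≢layer k i x k′ (block i′ x′) eq)
  entry-injective k i (inj₂ x) k′ i′ (inj₁ x′) eq = ⊥-elim (old≢layer k′ i′ x′ k (block i x) (sym eq))
  entry-injective k i (inj₂ x) k′ i′ (inj₂ x′) eq =
    let k≡k′ , blocks≡ = layer-injective h k k′ (block i x) (block i′ x′) eq
        i≡i′ , x≡x′    = block-injective i x i′ x′ blocks≡
    in k≡k′ , i≡i′ , cong inj₂ x≡x′

  entry-surjective : ∀ ω → ω ≢ + 0 → ∣ ω ∣ ≤ c * 12 + h → ∃₂ λ k i → ∃ λ u → entry k i u ≡ ω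
  entry-surjective ω ω≢0 ∣ω∣≤ with ∣ ω ∣ ℕ.≤? h
  ... | yes ∣ω∣≤h =
    let k , i , x , A≡ω = covers ω (Equivalence.from Ω-old (ω≢0 , ∣ω∣≤h)) in k , i , inj₁ x , A≡ω
  ... | no ∣ω∣≰h =
    let k , l , L≡ω      = layer-surjective h c ω (ℕ.≰⇒> ∣ω∣≰h) ∣ω∣≤
        i , x , block≡l = block-surjective l
    in k , i , inj₂ x , trans (cong (layer h k) block≡l) L≡ω

  entry-column-sum : ∀ k u → ∑ 6 (λ i → entry k i u) ≡ + 0
  entry-column-sum k (inj₁ x) = colSum k x
  entry-column-sum k (inj₂ x) = ∑-shifted-balanced 6 (λ i → block i x) (block-columns-balanced x) _

  extension : SMAS 6 (b + 4) c
  extension = record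
    { A         = λ k i j → entry k i (splitAt b j)
    ; inΩ       = λ k i j → Equivalence.from Ω-new (entry-bounds k i (splitAt b j))
    ; covers    = λ ω ω∈Ω → covered ω (Equivalence.to Ω-new ω∈Ω)
    ; injective = λ k i j k′ i′ j′ eq →
        let k≡k′ , i≡i′ , u≡u′ = entry-injective k i _ k′ i′ _ eq
        in k≡k′ , i≡i′ , splitAt-injective b j j′ u≡u′
    ; rowSum    = λ k i → trans (∑-splitAt b 4 (entry k i))
        (cong₂ ℤ._+_ (rowSum k i) (∑-shifted-balanced 4 (block i) (block-rows-balanced i) _))
    ; colSum    = λ k j → entry-column-sum k (splitAt b j)
    }
    where
    covered : ∀ ω → ω ≢ + 0 × ∣ ω ∣ ≤ c * 12 + h → ∃₂ λ k i → ∃ λ j → entry k i (splitAt b j) ≡ ω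
    covered ω (ω≢0 , ∣ω∣≤) =
      let k , i , u , entry≡ω = entry-surjective ω ω≢0 ∣ω∣≤
      in k , i , join b 4 u , trans (cong (entry k i) (splitAt-join b 4 u)) entry≡ω

lemma5p1 : (b c : ℕ) → b ≥ 1 → c ≥ 1 → SMAS 6 b c → SMAS 6 (b + 4) c
lemma5p1 b c _ _ S = Extension.extension S
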